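{- Let $m,n\ge 2$ and $k,\lambda\ge 1$ be integers, and let $D\subseteq\mathbb Z_{mn}$ be a cyclic relative difference set with parameters $(m,n;k,\lambda)$, relative to the subgroup $N$ of $\mathbb Z_{mn}$ of order $n$. Let $\mathrm{Dih}(2nm,\emptyset,D)$ be the Cayley graph $\mathrm{Cay}(D_{2nm},\{a^jb: j\in D\})$, where $D_{2nm}=\langle a,b\mid a^{nm}=b^2=1,\ bab=a^{ -1}\rangle$. Then $\mathrm{Dih}(2nm,\emptyset,D)$ is the point-block incidence graph of a group divisible design with the dual property with parameters $(n,m;k;0,\lambda)$. In particular, $\mathrm{Dih}(2nm,\emptyset,D)$ is a connected $2$-walk-regular graph.
   Context: A $k$-subset $D$ of a group $G$ of order $mn$ is an $(m,n;k,\lambda)$-relative difference set relative to a normal subgroup $N$ of order $n$ if every element of $G\setminus N$ has exactly $\lambda$ representations $r_1r_2^{ -1}$ (written $r_1-r_2$ additively) with $r_1,r_2\in D$, and no non-identity element of $N$ has such a representation; it is cyclic if $G$ is cyclic. For a group $G$ and inverse-closed $Q\subseteq G\setminus\{1\}$, $\mathrm{Cay}(G,Q)$ has vertex set $G$ with $g\sim h$ iff $g^{ -1}h\in Q$. A group divisible design $\mathrm{GDD}(n,m;k;\lambda_1,\lambda_2)$ is a triple $(\mathcal P,\mathcal G,\mathcal B)$ where $\mathcal G$ partitions the point set $\mathcal P$ into $m$ groups of size $n$ and $\mathcal B$ is a collection of $k$-subsets (blocks) such that two distinct points in the same group lie in exactly $\lambda_1$ common blocks and two points in different groups lie in exactly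 $\lambda_2$ common blocks; it has the dual property if its dual (blocks as points, points as blocks, same incidence) is a GDD with the same parameters. The point-block incidence graph has vertex set $\mathcal P\cup\mathcal B$ with a point adjacent to a block iff it lies in it. A graph is $2$-walk-regular if it has diameter at least $2$ and for every $\ell\ge0$ the number of walks of length $\ell$ between $x$ and $y$ depends only on $d(x,y)$ whenever $d(x,y)\le 2$. -}

module Defs where

open import Data.Nat using (ℕ; zero; suc; _+_; _*_; _∸_; _<_; _≤_)
open import Data.Nat.DivMod using (_mod_)
open import Data.Nat.Divisibility using (_∣_)
open import Data.Bool using (Bool; true; false; if_then_else_; _∧_; _xor_)
open import Data.Fin using (Fin; toℕ; _≟_) renaming (zero to fzero; suc to fsuc)
open import Data.Fin.Properties using (*↔×; +↔⊎; 2↔Bool)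
open import Data.Product using (Σ; _×_; _,_; ∃; ∃-syntax)
open import Data.Sum using (_⊎_; inj₁; inj₂)
open import Function using (flip)
open import Function.Bundles using (_↔_; Inverse)
open import Function.Properties.Inverse using (↔-trans; ↔-refl)
open import Data.Product.Function.NonDependent.Propositional using (_×-↔_)
open import Relation.Nullary using (¬_; does)
open import Relation.Binary.PropositionalEquality using (_≡_; _≢_)

sumFin : ∀ {N} → (Fin N → ℕ) → ℕ
sumFin {zero}  f = 0
sumFin {suc N} f = f fzero + sumFin (λ i → f (fsuc i))

count : ∀ {N} → (Fin N → Bool) → ℕ
count p = sumFin (λ i → if p i then 1 else 0)

_⊕_ : ∀ {N} → Fin N → Fin N → Fin N
_⊕_ {suc N} i j = (toℕ i + toℕ j) mod (suc N)

⊖_ : ∀ {N} → Fin N → Fin N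
⊖_ {suc N} i = (suc N ∸ toℕ i) mod (suc N)

_⊝_ : ∀ {N} → Fin N → Fin N → Fin N
i ⊝ j = i ⊕ (⊖ j)

-- Relative difference sets in ℤ_{mn}.
-- N = the unique subgroup of ℤ_{mn} of order n = { x : m ∣ x }.
-- D ⊆ ℤ_{mn} is given by its characteristic function.

diffCount : ∀ {N} → (Fin N → Bool) → Fin N → ℕ
diffCount D g =
  sumFin (λ r₁ → count (λ r₂ → D r₁ ∧ (D r₂ ∧ does ((r₁ ⊝ r₂) ≟ g))))

IsCyclicRDS : (m n k l : ℕ) → (Fin (m * n) → Bool) → Set
IsCyclicRDS m n k l D =
  (count D ≡ k)
  × (∀ g → ¬ (m ∣ toℕ g) → diffCount D g ≡ l)
  × (∀ g → m ∣ toℕ g → toℕ g ≢ 0 → diffCount D g ≡ 0)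

record FinGraph : Set₁ where
  field
    V    : Set
    size : ℕ
    enum : Fin size ↔ V
    adj  : V → V → Bool

open FinGraph public

_≅_ : FinGraph → FinGraph → Set
G ≅ H = Σ (V G ↔ V H) λ φ →
  ∀ x y → adj G x y ≡ adj H (Inverse.to φ x) (Inverse.to φ y)

walks : (G : FinGraph) → ℕ → V G → V G → ℕ
walks G zero    x y = if does (Inverse.from (enum G) x ≟ Inverse.from (enum G) y) then 1 else 0
walks G (suc ℓ) x y =
  sumFin (λ i → if adj G x (Inverse.to (enum G) i) then walks G ℓ (Inverse.to (enum G) i) y else 0)

Connected : FinGraph → Set
Connected G = ∀ x y → ∃[ ℓ ] (0 < walks G ℓ x y)

Dist : (G : FinGraph) → V G → V G → ℕ → Set
Dist G x y j = (0 < walks G j x y) × (∀ i → i < j → walks G i x y ≡ 0)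

-- diameter ≥ 2 : some pair of vertices at distance ≥ 2 (possibly ∞)
DiameterAtLeast2 : FinGraph → Set
DiameterAtLeast2 G = ∃[ x ] ∃[ y ] (walks G 0 x y ≡ 0 × walks G 1 x y ≡ 0)

TwoWalkRegular : FinGraph → Set
TwoWalkRegular G =
  DiameterAtLeast2 G
  × (∀ (ℓ j : ℕ) (x y x′ y′ : V G) → j ≤ 2 → Dist G x y j → Dist G x′ y′ j →
       walks G ℓ x y ≡ walks G ℓ x′ y′)

-- Dihedral group D_{2N} = ⟨ a , b | a^N = b^2 = 1 , bab = a⁻¹ ⟩ ;
-- (i , false) represents a^i and (i , true) represents a^i b.

Dih : ℕ → Set
Dih N = Fin N × Bool

dmul : ∀ {N} → Dih N → Dih N → Dih N
dmul (i , false) (j , f) = (i ⊕ j , f)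
dmul (i , true)  (j , f) = (i ⊝ j , true xor f)

dinv : ∀ {N} → Dih N → Dih N
dinv (i , false) = (⊖ i , false)
dinv (i , true)  = (i , true)

CayDih : (N : ℕ) → (Dih N → Bool) → FinGraph
CayDih N Q = record
  { V    = Dih N
  ; size = N * 2
  ; enum = ↔-trans *↔× (↔-refl ×-↔ 2↔Bool)
  ; adj  = λ g h → Q (dmul (dinv g) h)
  }

reflSet : ∀ {N} → (Fin N → Bool) → Dih N → Bool
reflSet D (j , false) = false
reflSet D (j , true)  = D j

DihGraph : (N : ℕ) → (Fin N → Bool) → FinGraph
DihGraph N D = CayDih N (reflSet D)

-- Group divisible designs.  Points Fin v, blocks Fin b (an indexed family,
-- so repeated blocks are allowed), incidence inc p B = "p ∈ B".
-- The groups are the fibres of grp : Fin v → Fin m.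

IsGDD : (n m k l₁ l₂ : ℕ) {v b : ℕ} → (Fin v → Fin b → Bool) → Set
IsGDD n m k l₁ l₂ {v} {b} inc =
  Σ (Fin v → Fin m) λ grp →
    (∀ (c : Fin m) → count (λ p → does (grp p ≟ c)) ≡ n)
    × (∀ (B : Fin b) → count (λ p → inc p B) ≡ k)
    × (∀ (p q : Fin v) → p ≢ q → grp p ≡ grp q → count (λ B → inc p B ∧ inc q B) ≡ l₁)
    × (∀ (p q : Fin v) → grp p ≢ grp q → count (λ B → inc p B ∧ inc q B) ≡ l₂)

IsGDDDual : (n m k l₁ l₂ : ℕ) {v b : ℕ} → (Fin v → Fin b → Bool) → Set
IsGDDDual n m k l₁ l₂ inc = IsGDD n m k l₁ l₂ inc × IsGDD n m k l₁ l₂ (flip inc)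

IncidenceGraph : {v b : ℕ} → (Fin v → Fin b → Bool) → FinGraph
IncidenceGraph {v} {b} inc = record
  { V    = Fin v ⊎ Fin b
  ; size = v + b
  ; enum = +↔⊎
  ; adj  = a
  }
  where
  a : Fin v ⊎ Fin b → Fin v ⊎ Fin b → Bool
  a (inj₁ p) (inj₂ B) = inc p B
  a (inj₂ B) (inj₁ p) = inc p B
  a _ _ = false

-- Rotations a^i are the points and reflections a^j b the blocks: a^i and a^j b are adjacent
-- iff j − i ∈ D, so the Cayley graph is the incidence graph of the blocks B − D.  The
-- number of blocks through two points p, q (dually, of points on two blocks) is the number
-- of r with r, r + (p − q) ∈ D, which the difference-set axioms fix to k, 0 or λ according
-- as p = q, p ≠ q lie in one coset of N, or in different cosets; this is the GDD with the
-- dual property.  On points the square of the adjacency matrix is therefore kI + λ(J − K),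
-- K being the indicator of a common coset.  As K² = nK, KJ = JK = nJ and J² = mnJ, the
-- span of I, K, J is closed under products, so the walks of any length between two points
-- are counted by αI + βK + γJ; and since a block meets each coset at most once, the walks
-- from a point to an incident block number α + β + γk.  Left multiplication by b swaps
-- points and blocks, so walk counts depend only on whether the distance is 0, 1 or 2.
-- Two points in different cosets have λ ≥ 1 common neighbours, and two points of one coset
-- are joined through a third coset, whence connectivity.

module Submission where

open import Algebra.Bundles using (Semiring; AbelianGroup)
open import Algebra.Structures using (IsAbelianGroup)
import Algebra.Properties.AbelianGroup as AbelianGroupProperties
import Algebra.Properties.Semiring.Sum as SemiringSum
open import Data.Bool using (Bool; true; false; if_then_else_; _∧_; not)
open import Data.Bool.Properties using (∧-comm; ∧-idem)
open import Data.Empty using (⊥-elim)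
open import Data.Fin using (Fin; toℕ; _≟_; _↑ˡ_; _↑ʳ_; combine; remQuot; cast) renaming (zero to fzero; suc to fsuc)
open import Data.Fin.Permutation using (Permutation; _⟨$⟩ʳ_)
open import Data.Fin.Properties
  using (toℕ-injective; toℕ<n; toℕ-fromℕ<; toℕ-combine; toℕ-cast; cast-involutive; remQuot-combine; 2↔Bool)
open import Data.Integer using (ℤ; +_) renaming (_+_ to _+ᶻ_; _*_ to _*ᶻ_; -_ to -ᶻ_)
import Data.Integer.Properties as ℤ
open import Data.Integer.Tactic.RingSolver using (solve-∀)
open import Data.Nat using (ℕ; zero; suc; _+_; _*_; _∸_; _<_; _≤_; z≤n; s≤s; z<s; _%_; NonZero)
open import Data.Nat.DivMod using (_mod_; %-distribˡ-+; m%n%n≡m%n; m<n⇒m%n≡m; n%n≡0; m∣n⇒o%n%m≡o%m; %-remove-+ˡ)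
open import Data.Nat.Divisibility using (_∣_; _∣0; m%n≡0⇒n∣m; n∣m⇒m%n≡0; m∣m*n; ∣1⇒≡1)
open import Data.Nat.Properties hiding (_≟_)
open import Data.Product using (Σ; _×_; _,_; ∃-syntax; proj₁; proj₂)
open import Data.Sum using (_⊎_; inj₁; inj₂)
open import Function using (_∘_; flip)
open import Function.Bundles using (_↔_; _⇔_; Inverse; Equivalence; mk↔ₛ′; mk⇔)
open import Function.Properties.Inverse using (↔-trans; ↔-sym)
open import Level using (0ℓ)
open import Relation.Binary.PropositionalEquality
open import Relation.Nullary using (¬_; Dec; does; yes; no)
open import Relation.Nullary.Decidable using (does-⇔; dec-true; dec-false)
open import Algebra.Properties.Semiring.Sum +-*-semiring
  using (sum; sum-syntax; ∑-comm; ∑-distrib-+; *-distribˡ-sum; *-distribʳ-sum; sum-cong-≗; ∑-permute; sum-replicate-zero)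

open import Defs

module Indicator {c ℓ} (R : Semiring c ℓ) where
  open Semiring R using (Carrier; _≈_; 0#; 1#)
  private
    module R = Semiring R
    module Σᴿ = SemiringSum R

  𝟙 : Bool → Carrier
  𝟙 b = if b then 1# else 0#

  sum-𝟙-≟ : ∀ {N} (f : Fin N → Carrier) j → Σᴿ.sum (λ i → 𝟙 (does (j ≟ i)) R.* f i) ≈ f j
  sum-𝟙-≟ {suc N} f fzero = R.trans
    (R.+-cong (R.*-identityˡ (f fzero)) (R.trans (Σᴿ.sum-cong-≋ (λ i → R.zeroˡ (f (fsuc i)))) (Σᴿ.sum-replicate-zero N)))
    (R.+-identityʳ (f fzero))
  sum-𝟙-≟ {suc N} f (fsuc j) =
    R.trans (R.+-cong (R.zeroˡ (f fzero)) (sum-𝟙-≟ (f ∘ fsuc) j)) (R.+-identityˡ (f (fsuc j)))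

open Indicator +-*-semiring public using (𝟙; sum-𝟙-≟)

does-≟-sym : ∀ {N} (i j : Fin N) → does (i ≟ j) ≡ does (j ≟ i)
does-≟-sym i j = does-⇔ (mk⇔ sym sym) (i ≟ j) (j ≟ i)

𝟙-∧ : ∀ a b → 𝟙 a * 𝟙 b ≡ 𝟙 (a ∧ b)
𝟙-∧ true  b = +-identityʳ (𝟙 b)
𝟙-∧ false b = refl

if-then-0 : ∀ b x → (if b then x else 0) ≡ 𝟙 b * x
if-then-0 true  x = sym (+-identityʳ x)
if-then-0 false x = refl

𝟙-∧-∧ : ∀ a b c → 𝟙 (a ∧ (b ∧ c)) ≡ 𝟙 c * 𝟙 (a ∧ b)
𝟙-∧-∧ true  true  c = sym (*-identityʳ (𝟙 c))
𝟙-∧-∧ true  false c = sym (*-zeroʳ (𝟙 c))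
𝟙-∧-∧ false b     c = sym (*-zeroʳ (𝟙 c))

𝟙-pos : ∀ {b} → 0 < 𝟙 b → b ≡ true
𝟙-pos {true} _ = refl

sumFin≡sum : ∀ {N} (f : Fin N → ℕ) → sumFin f ≡ ∑[ i < N ] f i
sumFin≡sum {zero}  f = refl
sumFin≡sum {suc N} f = cong (_+_ (f fzero)) (sumFin≡sum (f ∘ fsuc))

count-cong : ∀ {N} {p q : Fin N → Bool} → (∀ i → p i ≡ q i) → count p ≡ count q
count-cong {zero}  e = refl
count-cong {suc N} e = cong₂ _+_ (cong 𝟙 (e fzero)) (count-cong (e ∘ fsuc))

count-permute : ∀ {M N} (π : Permutation M N) (p : Fin N → Bool) → count p ≡ count (p ∘ (π ⟨$⟩ʳ_))
count-permute π p = trans (sumFin≡sum (𝟙 ∘ p))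
  (trans (∑-permute (𝟙 ∘ p) π) (sym (sumFin≡sum (𝟙 ∘ p ∘ (π ⟨$⟩ʳ_)))))

∑-const : ∀ N c → ∑[ i < N ] c ≡ N * c
∑-const zero    c = refl
∑-const (suc N) c = cong (_+_ c) (∑-const N c)

∑-≤ : ∀ {N} (f : Fin N → ℕ) i → f i ≤ ∑[ j < N ] f j
∑-≤ f fzero    = m≤m+n _ _
∑-≤ f (fsuc i) = ≤-trans (∑-≤ (f ∘ fsuc) i) (m≤n+m _ (f fzero))

∑-pos : ∀ {N} (f : Fin N → ℕ) → 0 < ∑[ i < N ] f i → ∃[ i ] 0 < f i
∑-pos {suc N} f p with f fzero in eq
... | suc _ = fzero , subst (0 <_) (sym eq) (s≤s z≤n)
... | zero  with ∑-pos (f ∘ fsuc) p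
...   | i , q = fsuc i , q

∑-↑ : ∀ a b (f : Fin (a + b) → ℕ) → ∑[ i < a + b ] f i ≡ ∑[ i < a ] f (i ↑ˡ b) + ∑[ j < b ] f (a ↑ʳ j)
∑-↑ zero    b f = refl
∑-↑ (suc a) b f = trans (cong (_+_ (f fzero)) (∑-↑ a b (f ∘ fsuc))) (sym (+-assoc (f fzero) _ _))

∑-combine : ∀ a b (f : Fin (a * b) → ℕ) → ∑[ i < a * b ] f i ≡ ∑[ i < a ] ∑[ j < b ] f (combine i j)
∑-combine zero    b f = refl
∑-combine (suc a) b f = trans (∑-↑ b (a * b) f) (cong (_+_ (∑[ j < b ] f (j ↑ˡ (a * b)))) (∑-combine a b (f ∘ (b ↑ʳ_))))

module _ {K : ℕ} where
  private
    N : ℕ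
    N = suc K

  toℕ-⊕ : ∀ (a b : Fin N) → toℕ (a ⊕ b) ≡ (toℕ a + toℕ b) % N
  toℕ-⊕ a b = toℕ-fromℕ< _

  toℕ-⊖ : ∀ (a : Fin N) → toℕ (⊖ a) ≡ (N ∸ toℕ a) % N
  toℕ-⊖ a = toℕ-fromℕ< _

  %-absorbˡ : ∀ x y → (x % N + y) % N ≡ (x + y) % N
  %-absorbˡ x y = begin
    (x % N + y) % N          ≡⟨ %-distribˡ-+ (x % N) y N ⟩
    (x % N % N + y % N) % N  ≡⟨ cong (λ z → (z + y % N) % N) (m%n%n≡m%n x N) ⟩
    (x % N + y % N) % N      ≡⟨ %-distribˡ-+ x y N ⟨
    (x + y) % N              ∎
    where open ≡-Reasoning

  ⊕-comm : ∀ (a b : Fin N) → a ⊕ b ≡ b ⊕ a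
  ⊕-comm a b = cong (_mod N) (+-comm (toℕ a) (toℕ b))

  ⊕-assoc : ∀ (a b c : Fin N) → (a ⊕ b) ⊕ c ≡ a ⊕ (b ⊕ c)
  ⊕-assoc a b c = toℕ-injective (begin
    toℕ ((a ⊕ b) ⊕ c)                    ≡⟨ toℕ-⊕ (a ⊕ b) c ⟩
    (toℕ (a ⊕ b) + toℕ c) % N            ≡⟨ cong (λ z → (z + toℕ c) % N) (toℕ-⊕ a b) ⟩
    ((toℕ a + toℕ b) % N + toℕ c) % N    ≡⟨ %-absorbˡ (toℕ a + toℕ b) (toℕ c) ⟩
    (toℕ a + toℕ b + toℕ c) % N          ≡⟨ cong (_% N) (+-assoc (toℕ a) (toℕ b) (toℕ c)) ⟩
    (toℕ a + (toℕ b + toℕ c)) % N        ≡⟨ cong (_% N) (+-comm (toℕ a) _) ⟩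
    (toℕ b + toℕ c + toℕ a) % N          ≡⟨ %-absorbˡ (toℕ b + toℕ c) (toℕ a) ⟨
    ((toℕ b + toℕ c) % N + toℕ a) % N    ≡⟨ cong (λ z → (z + toℕ a) % N) (toℕ-⊕ b c) ⟨
    (toℕ (b ⊕ c) + toℕ a) % N            ≡⟨ cong (_% N) (+-comm (toℕ (b ⊕ c)) (toℕ a)) ⟩
    (toℕ a + toℕ (b ⊕ c)) % N            ≡⟨ toℕ-⊕ a (b ⊕ c) ⟨
    toℕ (a ⊕ (b ⊕ c))                    ∎)
    where open ≡-Reasoning

  ⊕-identityˡ : ∀ (a : Fin N) → fzero ⊕ a ≡ a
  ⊕-identityˡ a = toℕ-injective (trans (toℕ-⊕ fzero a) (m<n⇒m%n≡m (toℕ<n a)))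

  ⊕-identityʳ : ∀ (a : Fin N) → a ⊕ fzero ≡ a
  ⊕-identityʳ a = trans (⊕-comm a fzero) (⊕-identityˡ a)

  ⊕-inverseˡ : ∀ (a : Fin N) → (⊖ a) ⊕ a ≡ fzero
  ⊕-inverseˡ a = toℕ-injective (begin
    toℕ ((⊖ a) ⊕ a)                  ≡⟨ toℕ-⊕ (⊖ a) a ⟩
    (toℕ (⊖ a) + toℕ a) % N          ≡⟨ cong (λ z → (z + toℕ a) % N) (toℕ-⊖ a) ⟩
    ((N ∸ toℕ a) % N + toℕ a) % N    ≡⟨ %-absorbˡ (N ∸ toℕ a) (toℕ a) ⟩
    (N ∸ toℕ a + toℕ a) % N          ≡⟨ cong (_% N) (m∸n+n≡m (<⇒≤ (toℕ<n a))) ⟩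
    N % N                            ≡⟨ n%n≡0 N ⟩
    0                                ∎)
    where open ≡-Reasoning

  ⊕-inverseʳ : ∀ (a : Fin N) → a ⊕ (⊖ a) ≡ fzero
  ⊕-inverseʳ a = trans (⊕-comm a (⊖ a)) (⊕-inverseˡ a)

  ⊕-isAbelianGroup : IsAbelianGroup _≡_ _⊕_ fzero (⊖_ {N})
  ⊕-isAbelianGroup = record
    { isGroup = record
      { isMonoid = record
        { isSemigroup = record
          { isMagma  = record { isEquivalence = isEquivalence ; ∙-cong = cong₂ _⊕_ }
          ; assoc    = ⊕-assoc
          }
        ; identity = ⊕-identityˡ , ⊕-identityʳ
        }
      ; inverse  = ⊕-inverseˡ , ⊕-inverseʳ
      ; ⁻¹-cong  = cong ⊖_
      }
    ; comm    = ⊕-comm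
    }

ℤ/-abelianGroup : ℕ → AbelianGroup 0ℓ 0ℓ
ℤ/-abelianGroup K = record { isAbelianGroup = ⊕-isAbelianGroup {K} }

module ℤ/ {K : ℕ} = AbelianGroupProperties (ℤ/-abelianGroup K)

module _ {K : ℕ} where
  private
    N : ℕ
    N = suc K

  ⊝-involutive : ∀ (a b : Fin N) → a ⊝ (a ⊝ b) ≡ b
  ⊝-involutive a b = begin
    a ⊕ (⊖ (a ⊝ b))  ≡⟨ cong (a ⊕_) (ℤ/.⁻¹-anti-homo‿- a b) ⟩
    a ⊕ (b ⊝ a)      ≡⟨ ⊕-assoc a b (⊖ a) ⟨
    (a ⊕ b) ⊝ a      ≡⟨ ℤ/.xyx⁻¹≈y a b ⟩
    b                ∎
    where open ≡-Reasoning

  ⊖-⊕-shift : ∀ (a b c : Fin N) → (⊖ a) ⊕ (b ⊕ c) ≡ c ⊕ (b ⊝ a)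
  ⊖-⊕-shift a b c = begin
    (⊖ a) ⊕ (b ⊕ c)  ≡⟨ ⊕-assoc (⊖ a) b c ⟨
    ((⊖ a) ⊕ b) ⊕ c  ≡⟨ ⊕-comm ((⊖ a) ⊕ b) c ⟩
    c ⊕ ((⊖ a) ⊕ b)  ≡⟨ cong (c ⊕_) (⊕-comm (⊖ a) b) ⟩
    c ⊕ (b ⊝ a)      ∎
    where open ≡-Reasoning

  ⊝-⊕-shift : ∀ (a b c : Fin N) → (a ⊝ b) ⊕ c ≡ a ⊕ (c ⊝ b)
  ⊝-⊕-shift a b c = trans (⊕-assoc a (⊖ b) c) (cong (a ⊕_) (⊕-comm (⊖ b) c))

  translation reflection : Fin N → Permutation N N
  translation a = mk↔ₛ′ (a ⊕_) ((⊖ a) ⊕_) (ℤ/.\\-leftDividesˡ a) (ℤ/.\\-leftDividesʳ a)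
  reflection  a = mk↔ₛ′ (a ⊝_) (a ⊝_) (⊝-involutive a) (⊝-involutive a)

module Reduction {K M : ℕ} (M∣K : suc M ∣ suc K) where
  private
    m : ℕ
    m = suc M

  reduce : Fin (suc K) → Fin m
  reduce x = toℕ x mod m

  toℕ-reduce : ∀ a → toℕ (reduce a) ≡ toℕ a % m
  toℕ-reduce a = toℕ-fromℕ< _

  reduce-⊕ : ∀ a b → reduce (a ⊕ b) ≡ reduce a ⊕ reduce b
  reduce-⊕ a b = toℕ-injective (begin
    toℕ (reduce (a ⊕ b))           ≡⟨ toℕ-reduce (a ⊕ b) ⟩
    toℕ (a ⊕ b) % m                ≡⟨ cong (_% m) (toℕ-⊕ a b) ⟩
    (toℕ a + toℕ b) % suc K % m    ≡⟨ m∣n⇒o%n%m≡o%m m (suc K) (toℕ a + toℕ b) M∣K ⟩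
    (toℕ a + toℕ b) % m            ≡⟨ %-distribˡ-+ (toℕ a) (toℕ b) m ⟩
    (toℕ a % m + toℕ b % m) % m    ≡⟨ cong₂ (λ u v → (u + v) % m) (toℕ-reduce a) (toℕ-reduce b) ⟨
    (toℕ (reduce a) + toℕ (reduce b)) % m ≡⟨ toℕ-⊕ (reduce a) (reduce b) ⟨
    toℕ (reduce a ⊕ reduce b)      ∎)
    where open ≡-Reasoning

  reduce-⊖ : ∀ a → reduce (⊖ a) ≡ ⊖ reduce a
  reduce-⊖ a = ℤ/.inverseˡ-unique (reduce (⊖ a)) (reduce a)
    (trans (sym (reduce-⊕ (⊖ a) a)) (cong reduce (⊕-inverseˡ a)))

  reduce-⊝ : ∀ a b → reduce (a ⊝ b) ≡ reduce a ⊝ reduce b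
  reduce-⊝ a b = trans (reduce-⊕ a (⊖ b)) (cong (reduce a ⊕_) (reduce-⊖ b))

  reduce≡0⇒∣ : ∀ g → reduce g ≡ fzero → m ∣ toℕ g
  reduce≡0⇒∣ g e = m%n≡0⇒n∣m (toℕ g) m (trans (sym (toℕ-reduce g)) (cong toℕ e))

  ∣⇒reduce≡0 : ∀ g → m ∣ toℕ g → reduce g ≡ fzero
  ∣⇒reduce≡0 g d = toℕ-injective (trans (toℕ-reduce g) (n∣m⇒m%n≡0 (toℕ g) m d))

  reduce-≡⇒∣ : ∀ a b → reduce a ≡ reduce b → m ∣ toℕ (a ⊝ b)
  reduce-≡⇒∣ a b e = reduce≡0⇒∣ (a ⊝ b)
    (trans (reduce-⊝ a b) (ℤ/.x≈y⇒x∙y⁻¹≈ε e))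

  ∣⇒reduce-≡ : ∀ a b → m ∣ toℕ (a ⊝ b) → reduce a ≡ reduce b
  ∣⇒reduce-≡ a b d = ℤ/.x∙y⁻¹≈ε⇒x≈y (reduce a) (reduce b)
    (trans (sym (reduce-⊝ a b)) (∣⇒reduce≡0 (a ⊝ b) d))

count-mod : ∀ m n .{{_ : NonZero m}} (c : Fin m) → count {m * n} (λ p → does ((toℕ p mod m) ≟ c)) ≡ n
count-mod m n c = begin
  count residue                                            ≡⟨ count-permute commute residue ⟩
  count (residue ∘ (commute ⟨$⟩ʳ_))                        ≡⟨ sumFin≡sum (𝟙 ∘ residue ∘ (commute ⟨$⟩ʳ_)) ⟩
  ∑[ p < n * m ] 𝟙 (residue (commute ⟨$⟩ʳ p))              ≡⟨ ∑-combine n m (𝟙 ∘ residue ∘ (commute ⟨$⟩ʳ_)) ⟩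
  ∑[ q < n ] ∑[ r < m ] 𝟙 (residue (commute ⟨$⟩ʳ combine q r))
    ≡⟨ sum-cong-≗ {n} (λ q → sum-cong-≗ {m} (λ r → trans (cong 𝟙 (residue-combine q r)) (sym (*-identityʳ _)))) ⟩
  ∑[ q < n ] ∑[ r < m ] (𝟙 (does (c ≟ r)) * 1)             ≡⟨ sum-cong-≗ {n} (λ q → sum-𝟙-≟ (λ _ → 1) c) ⟩
  ∑[ q < n ] 1                                             ≡⟨ ∑-const n 1 ⟩
  n * 1                                                    ≡⟨ *-identityʳ n ⟩
  n                                                        ∎
  where
  open ≡-Reasoning
  residue : Fin (m * n) → Bool
  residue p = does ((toℕ p mod m) ≟ c)
  -- Reading Fin (m * n) as Fin (n * m) makes combine q r the number m * q + r.
  commute : Permutation (n * m) (m * n)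
  commute = mk↔ₛ′ (cast (*-comm n m)) (cast (*-comm m n))
    (cast-involutive (*-comm n m) (*-comm m n)) (cast-involutive (*-comm m n) (*-comm n m))
  residue-combine : ∀ q r → residue (commute ⟨$⟩ʳ combine q r) ≡ does (c ≟ r)
  residue-combine q r = does-⇔
    (mk⇔ (λ e → trans (sym e) (toℕ-injective toℕ-residue)) (λ e → trans (toℕ-injective toℕ-residue) (sym e)))
    ((toℕ (commute ⟨$⟩ʳ combine q r) mod m) ≟ c) (c ≟ r)
    where
    toℕ-residue : toℕ ((toℕ (commute ⟨$⟩ʳ combine q r)) mod m) ≡ toℕ r
    toℕ-residue = begin
      toℕ ((toℕ (commute ⟨$⟩ʳ combine q r)) mod m)
        ≡⟨ toℕ-fromℕ< _ ⟩
      toℕ (commute ⟨$⟩ʳ combine q r) % m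
        ≡⟨ cong (_% m) (trans (toℕ-cast (*-comm n m) (combine q r)) (toℕ-combine q r)) ⟩
      (m * toℕ q + toℕ r) % m
        ≡⟨ %-remove-+ˡ (toℕ r) (m∣m*n (toℕ q)) ⟩
      toℕ r % m
        ≡⟨ m<n⇒m%n≡m (toℕ<n r) ⟩
      toℕ r
        ∎

module WalkCounts (G : FinGraph) where
  private
    S : ℕ
    S = size G
    to : Fin S → V G
    to = Inverse.to (enum G)
    from : V G → Fin S
    from = Inverse.from (enum G)

  ∑ᵥ : (V G → ℕ) → ℕ
  ∑ᵥ f = ∑[ i < S ] f (to i)

  walks-suc : ∀ ℓ x y → walks G (suc ℓ) x y ≡ ∑ᵥ (λ z → 𝟙 (adj G x z) * walks G ℓ z y)
  walks-suc ℓ x y = trans (sumFin≡sum (λ i → if adj G x (to i) then walks G ℓ (to i) y else 0))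
    (sum-cong-≗ {S} (λ i → if-then-0 (adj G x (to i)) (walks G ℓ (to i) y)))

  private
    from-injective : ∀ {x y} → from x ≡ from y → x ≡ y
    from-injective {x} {y} e = trans (sym (Inverse.strictlyInverseˡ (enum G) x))
      (trans (cong to e) (Inverse.strictlyInverseˡ (enum G) y))

  walks-zero : ∀ {P : Set} (P? : Dec P) x y → x ≡ y ⇔ P → walks G 0 x y ≡ 𝟙 (does P?)
  walks-zero P? x y x≡y⇔P = cong 𝟙 (does-⇔
    (mk⇔ (Equivalence.to x≡y⇔P ∘ from-injective) (cong from ∘ Equivalence.from x≡y⇔P))
    (from x ≟ from y) P?)

  walks-zero-≢ : ∀ {x y} → x ≢ y → walks G 0 x y ≡ 0
  walks-zero-≢ {x} {y} x≢y = cong 𝟙 (dec-false (from x ≟ from y) (x≢y ∘ from-injective))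

  walks-zero-refl : ∀ x → walks G 0 x x ≡ 1
  walks-zero-refl x = cong 𝟙 (dec-true (from x ≟ from x) refl)

  walks-zero-pos : ∀ {x y} → 0 < walks G 0 x y → x ≡ y
  walks-zero-pos {x} {y} p with from x ≟ from y
  ... | yes e = from-injective e
  ... | no  _ = ⊥-elim (<-irrefl refl p)

  ∑ᵥ-walks-zero : ∀ (f : V G → ℕ) x → ∑ᵥ (λ z → walks G 0 x z * f z) ≡ f x
  ∑ᵥ-walks-zero f x = begin
    ∑[ i < S ] (𝟙 (does (from x ≟ from (to i))) * f (to i))
      ≡⟨ sum-cong-≗ {S} (λ i → cong (λ j → 𝟙 (does (from x ≟ j)) * f (to i)) (Inverse.strictlyInverseʳ (enum G) i)) ⟩
    ∑[ i < S ] (𝟙 (does (from x ≟ i)) * f (to i)) ≡⟨ sum-𝟙-≟ (f ∘ to) (from x) ⟩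
    f (to (from x))                                ≡⟨ cong f (Inverse.strictlyInverseˡ (enum G) x) ⟩
    f x                                            ∎
    where open ≡-Reasoning

  walks-one : ∀ x y → walks G 1 x y ≡ 𝟙 (adj G x y)
  walks-one x y = begin
    walks G 1 x y                                        ≡⟨ walks-suc 0 x y ⟩
    ∑ᵥ (λ z → 𝟙 (adj G x z) * walks G 0 z y)             ≡⟨ sum-cong-≗ {S} (λ i → *-comm (𝟙 (adj G x (to i))) _) ⟩
    ∑ᵥ (λ z → 𝟙 (does (from z ≟ from y)) * 𝟙 (adj G x z))
      ≡⟨ sum-cong-≗ {S} (λ i → cong (_* 𝟙 (adj G x (to i))) (cong 𝟙 (does-≟-sym (from (to i)) (from y)))) ⟩
    ∑ᵥ (λ z → walks G 0 y z * 𝟙 (adj G x z))             ≡⟨ ∑ᵥ-walks-zero (λ z → 𝟙 (adj G x z)) y ⟩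
    𝟙 (adj G x y)                                        ∎
    where open ≡-Reasoning

  walks-+ : ∀ ℓ₁ ℓ₂ x y → walks G (ℓ₁ + ℓ₂) x y ≡ ∑ᵥ (λ z → walks G ℓ₁ x z * walks G ℓ₂ z y)
  walks-+ zero      ℓ₂ x y = sym (∑ᵥ-walks-zero (λ z → walks G ℓ₂ z y) x)
  walks-+ (suc ℓ₁) ℓ₂ x y = begin
    walks G (suc (ℓ₁ + ℓ₂)) x y
      ≡⟨ walks-suc (ℓ₁ + ℓ₂) x y ⟩
    ∑ᵥ (λ z → A z * walks G (ℓ₁ + ℓ₂) z y)
      ≡⟨ sum-cong-≗ {S} (λ i → cong (A (to i) *_) (walks-+ ℓ₁ ℓ₂ (to i) y)) ⟩
    ∑ᵥ (λ z → A z * ∑ᵥ (λ w → walks G ℓ₁ z w * walks G ℓ₂ w y))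
      ≡⟨ sum-cong-≗ {S} (λ i → *-distribˡ-sum (A (to i)) (λ j → walks G ℓ₁ (to i) (to j) * walks G ℓ₂ (to j) y)) ⟩
    ∑ᵥ (λ z → ∑ᵥ (λ w → A z * (walks G ℓ₁ z w * walks G ℓ₂ w y)))
      ≡⟨ ∑-comm (λ i j → A (to i) * (walks G ℓ₁ (to i) (to j) * walks G ℓ₂ (to j) y)) ⟩
    ∑ᵥ (λ w → ∑ᵥ (λ z → A z * (walks G ℓ₁ z w * walks G ℓ₂ w y)))
      ≡⟨ sum-cong-≗ {S} (λ j → sum-cong-≗ {S} (λ i → sym (*-assoc (A (to i)) _ _))) ⟩
    ∑ᵥ (λ w → ∑ᵥ (λ z → A z * walks G ℓ₁ z w * walks G ℓ₂ w y))
      ≡⟨ sum-cong-≗ {S} (λ j → *-distribʳ-sum (walks G ℓ₂ (to j) y) (λ i → A (to i) * walks G ℓ₁ (to i) (to j))) ⟨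
    ∑ᵥ (λ w → ∑ᵥ (λ z → A z * walks G ℓ₁ z w) * walks G ℓ₂ w y)
      ≡⟨ sum-cong-≗ {S} (λ j → cong (_* walks G ℓ₂ (to j) y) (walks-suc ℓ₁ x (to j))) ⟨
    ∑ᵥ (λ w → walks G (suc ℓ₁) x w * walks G ℓ₂ w y)
      ∎
    where
    open ≡-Reasoning
    A : V G → ℕ
    A z = 𝟙 (adj G x z)

  walks-through : ∀ ℓ₁ ℓ₂ x z y → walks G ℓ₁ x z * walks G ℓ₂ z y ≤ walks G (ℓ₁ + ℓ₂) x y
  walks-through ℓ₁ ℓ₂ x z y =
    subst₂ _≤_ (cong (λ w → walks G ℓ₁ x w * walks G ℓ₂ w y) (Inverse.strictlyInverseˡ (enum G) z))
               (sym (walks-+ ℓ₁ ℓ₂ x y))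
               (∑-≤ (λ i → walks G ℓ₁ x (to i) * walks G ℓ₂ (to i) y) (from z))

  module _ (φ : V G ↔ V G) (φ-adj : ∀ x y → adj G (Inverse.to φ x) (Inverse.to φ y) ≡ adj G x y) where
    private
      φ′ : V G → V G
      φ′ = Inverse.to φ

      relabel : Permutation S S
      relabel = ↔-trans (enum G) (↔-trans φ (↔-sym (enum G)))

    ∑ᵥ-automorphism : ∀ f → ∑ᵥ (f ∘ φ′) ≡ ∑ᵥ f
    ∑ᵥ-automorphism f = sym (trans (∑-permute (f ∘ to) relabel)
      (sum-cong-≗ {S} (λ i → cong f (Inverse.strictlyInverseˡ (enum G) (φ′ (to i))))))

    walks-automorphism : ∀ ℓ x y → walks G ℓ (φ′ x) (φ′ y) ≡ walks G ℓ x y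
    walks-automorphism zero x y = cong 𝟙 (does-⇔
      (mk⇔ (λ e → cong from (φ-injective (from-injective e))) (λ e → cong (from ∘ φ′) (from-injective e)))
      (from (φ′ x) ≟ from (φ′ y)) (from x ≟ from y))
      where
      φ-injective : ∀ {x y} → φ′ x ≡ φ′ y → x ≡ y
      φ-injective {x} {y} e = trans (sym (Inverse.strictlyInverseʳ φ x))
        (trans (cong (Inverse.from φ) e) (Inverse.strictlyInverseʳ φ y))
    walks-automorphism (suc ℓ) x y = begin
      walks G (suc ℓ) (φ′ x) (φ′ y)                            ≡⟨ walks-suc ℓ (φ′ x) (φ′ y) ⟩
      ∑ᵥ (λ z → 𝟙 (adj G (φ′ x) z) * walks G ℓ z (φ′ y))
        ≡⟨ ∑ᵥ-automorphism (λ z → 𝟙 (adj G (φ′ x) z) * walks G ℓ z (φ′ y)) ⟨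
      ∑ᵥ (λ z → 𝟙 (adj G (φ′ x) (φ′ z)) * walks G ℓ (φ′ z) (φ′ y))
        ≡⟨ sum-cong-≗ {S} (λ i → cong₂ _*_ (cong 𝟙 (φ-adj x (to i))) (walks-automorphism ℓ (to i) y)) ⟩
      ∑ᵥ (λ z → 𝟙 (adj G x z) * walks G ℓ z y)                 ≡⟨ walks-suc ℓ x y ⟨
      walks G (suc ℓ) x y                                      ∎
      where open ≡-Reasoning

module ∑ᶻ = SemiringSum ℤ.+-*-semiring
open Indicator ℤ.+-*-semiring using () renaming (𝟙 to 𝟙ᶻ; sum-𝟙-≟ to ∑ᶻ-𝟙-≟)

+-𝟙 : ∀ b → + 𝟙 b ≡ 𝟙ᶻ b
+-𝟙 true  = refl
+-𝟙 false = refl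

+-∑ : ∀ {N} (f : Fin N → ℕ) → + (∑[ i < N ] f i) ≡ ∑ᶻ.sum (λ i → + f i)
+-∑ {zero}  f = refl
+-∑ {suc N} f = trans (ℤ.pos-+ (f fzero) _) (cong (+ f fzero +ᶻ_) (+-∑ (f ∘ fsuc)))

module GroupDivisibleMatrices {N M : ℕ} (grp : Fin N → Fin M) (n : ℕ)
         (fibre : ∀ c → count (λ p → does (grp p ≟ c)) ≡ n) where

  δ χ : Fin N → Fin N → ℤ
  δ i a = 𝟙ᶻ (does (i ≟ a))
  χ i a = 𝟙ᶻ (does (grp i ≟ grp a))

  Coeffs : Set
  Coeffs = ℤ × ℤ × ℤ

  -- ⟦ α , β , γ ⟧ is the matrix αI + βK + γJ, with K = χ and J the all-ones matrix.
  ⟦_⟧ : Coeffs → Fin N → Fin N → ℤ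
  ⟦ α , β , γ ⟧ i a = α *ᶻ δ i a +ᶻ β *ᶻ χ i a +ᶻ γ

  -- (αI + βK + γJ)(α′I + β′K + γ′J), using K² = nK, KJ = JK = nJ and J² = NJ
  _⊛_ : Coeffs → Coeffs → Coeffs
  (α , β , γ) ⊛ (α′ , β′ , γ′) =
    α *ᶻ α′ ,
    α *ᶻ β′ +ᶻ β *ᶻ α′ +ᶻ + n *ᶻ β *ᶻ β′ ,
    α *ᶻ γ′ +ᶻ γ *ᶻ α′ +ᶻ + n *ᶻ (β *ᶻ γ′ +ᶻ γ *ᶻ β′) +ᶻ + N *ᶻ γ *ᶻ γ′

  χ-sym : ∀ i a → χ i a ≡ χ a i
  χ-sym i a = cong 𝟙ᶻ (does-≟-sym (grp i) (grp a))

  ⟦⟧-sym : ∀ c i a → ⟦ c ⟧ i a ≡ ⟦ c ⟧ a i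
  ⟦⟧-sym (α , β , γ) i a =
    cong₂ (λ d x → α *ᶻ d +ᶻ β *ᶻ x +ᶻ γ) (cong 𝟙ᶻ (does-≟-sym i a)) (χ-sym i a)

  ⟦⟧-diagonal : ∀ c i → ⟦ c ⟧ i i ≡ (let (α , β , γ) = c in α +ᶻ β +ᶻ γ)
  ⟦⟧-diagonal (α , β , γ) i = trans
    (cong₂ (λ d x → α *ᶻ 𝟙ᶻ d +ᶻ β *ᶻ 𝟙ᶻ x +ᶻ γ) (dec-true (i ≟ i) refl) (dec-true (grp i ≟ grp i) refl))
    (cong₂ (λ u v → u +ᶻ v +ᶻ γ) (ℤ.*-identityʳ α) (ℤ.*-identityʳ β))

  ⟦⟧-within : ∀ c i a → i ≢ a → grp i ≡ grp a → ⟦ c ⟧ i a ≡ (let (_ , β , γ) = c in β +ᶻ γ)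
  ⟦⟧-within (α , β , γ) i a i≢a i∼a = trans
    (cong₂ (λ d x → α *ᶻ 𝟙ᶻ d +ᶻ β *ᶻ 𝟙ᶻ x +ᶻ γ) (dec-false (i ≟ a) i≢a) (dec-true (grp i ≟ grp a) i∼a))
    (cong (_+ᶻ γ) (trans (cong₂ _+ᶻ_ (ℤ.*-zeroʳ α) (ℤ.*-identityʳ β)) (ℤ.+-identityˡ β)))

  ⟦⟧-apart : ∀ c i a → grp i ≢ grp a → ⟦ c ⟧ i a ≡ (let (_ , _ , γ) = c in γ)
  ⟦⟧-apart (α , β , γ) i a i≁a = trans
    (cong₂ (λ d x → α *ᶻ 𝟙ᶻ d +ᶻ β *ᶻ 𝟙ᶻ x +ᶻ γ)
           (dec-false (i ≟ a) (i≁a ∘ cong grp)) (dec-false (grp i ≟ grp a) i≁a))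
    (trans (cong (_+ᶻ γ) (cong₂ _+ᶻ_ (ℤ.*-zeroʳ α) (ℤ.*-zeroʳ β))) (ℤ.+-identityˡ γ))

  ∑-χ : ∀ i → ∑ᶻ.sum (λ a → χ a i) ≡ + n
  ∑-χ i = begin
    ∑ᶻ.sum (λ a → 𝟙ᶻ (does (grp a ≟ grp i)))     ≡⟨ ∑ᶻ.sum-cong-≗ (λ a → +-𝟙 (does (grp a ≟ grp i))) ⟨
    ∑ᶻ.sum (λ a → + 𝟙 (does (grp a ≟ grp i)))    ≡⟨ +-∑ (λ a → 𝟙 (does (grp a ≟ grp i))) ⟨
    + ∑[ a < N ] 𝟙 (does (grp a ≟ grp i))
      ≡⟨ cong +_ (trans (sym (sumFin≡sum (λ a → 𝟙 (does (grp a ≟ grp i))))) (fibre (grp i))) ⟩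
    + n                                          ∎
    where open ≡-Reasoning

  ∑-χχ : ∀ i b → ∑ᶻ.sum (λ a → χ i a *ᶻ χ a b) ≡ χ i b *ᶻ + n
  ∑-χχ i b = begin
    ∑ᶻ.sum (λ a → χ i a *ᶻ χ a b)   ≡⟨ ∑ᶻ.sum-cong-≗ transfer ⟩
    ∑ᶻ.sum (λ a → χ i b *ᶻ χ a b)   ≡⟨ ∑ᶻ.*-distribˡ-sum (χ i b) (λ a → χ a b) ⟨
    χ i b *ᶻ ∑ᶻ.sum (λ a → χ a b)   ≡⟨ cong (χ i b *ᶻ_) (∑-χ b) ⟩
    χ i b *ᶻ + n                    ∎
    where
    open ≡-Reasoning
    transfer : ∀ a → χ i a *ᶻ χ a b ≡ χ i b *ᶻ χ a b
    transfer a with grp a ≟ grp b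
    ... | yes a∼b = cong (λ c → 𝟙ᶻ (does (grp i ≟ c)) *ᶻ + 1) a∼b
    ... | no  _   = trans (ℤ.*-zeroʳ (χ i a)) (sym (ℤ.*-zeroʳ (χ i b)))

  ∑-⟦⟧ : ∀ c i (Y : Fin N → ℤ) → ∑ᶻ.sum (λ a → ⟦ c ⟧ i a *ᶻ Y a) ≡
    (let (α , β , γ) = c in α *ᶻ Y i +ᶻ β *ᶻ ∑ᶻ.sum (λ a → χ i a *ᶻ Y a) +ᶻ γ *ᶻ ∑ᶻ.sum Y)
  ∑-⟦⟧ (α , β , γ) i Y = begin
    ∑ᶻ.sum (λ a → ⟦ α , β , γ ⟧ i a *ᶻ Y a)
      ≡⟨ ∑ᶻ.sum-cong-≗ (λ a → expand α β γ (δ i a) (χ i a) (Y a)) ⟩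
    ∑ᶻ.sum (λ a → α *ᶻ (δ i a *ᶻ Y a) +ᶻ β *ᶻ (χ i a *ᶻ Y a) +ᶻ γ *ᶻ Y a)
      ≡⟨ ∑ᶻ.∑-distrib-+ (λ a → α *ᶻ (δ i a *ᶻ Y a) +ᶻ β *ᶻ (χ i a *ᶻ Y a)) (λ a → γ *ᶻ Y a) ⟩
    ∑ᶻ.sum (λ a → α *ᶻ (δ i a *ᶻ Y a) +ᶻ β *ᶻ (χ i a *ᶻ Y a)) +ᶻ ∑ᶻ.sum (λ a → γ *ᶻ Y a)
      ≡⟨ cong (_+ᶻ ∑ᶻ.sum (λ a → γ *ᶻ Y a)) (∑ᶻ.∑-distrib-+ (λ a → α *ᶻ (δ i a *ᶻ Y a)) (λ a → β *ᶻ (χ i a *ᶻ Y a))) ⟩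
    ∑ᶻ.sum (λ a → α *ᶻ (δ i a *ᶻ Y a)) +ᶻ ∑ᶻ.sum (λ a → β *ᶻ (χ i a *ᶻ Y a)) +ᶻ ∑ᶻ.sum (λ a → γ *ᶻ Y a)
      ≡⟨ cong₂ _+ᶻ_ (cong₂ _+ᶻ_ (∑ᶻ.*-distribˡ-sum α (λ a → δ i a *ᶻ Y a))
                               (∑ᶻ.*-distribˡ-sum β (λ a → χ i a *ᶻ Y a)))
                    (∑ᶻ.*-distribˡ-sum γ Y) ⟨
    α *ᶻ ∑ᶻ.sum (λ a → δ i a *ᶻ Y a) +ᶻ β *ᶻ ∑ᶻ.sum (λ a → χ i a *ᶻ Y a) +ᶻ γ *ᶻ ∑ᶻ.sum Y
      ≡⟨ cong (λ t → α *ᶻ t +ᶻ β *ᶻ ∑ᶻ.sum (λ a → χ i a *ᶻ Y a) +ᶻ γ *ᶻ ∑ᶻ.sum Y) (∑ᶻ-𝟙-≟ Y i) ⟩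
    α *ᶻ Y i +ᶻ β *ᶻ ∑ᶻ.sum (λ a → χ i a *ᶻ Y a) +ᶻ γ *ᶻ ∑ᶻ.sum Y
      ∎
    where
    open ≡-Reasoning
    expand : ∀ α β γ d x y → (α *ᶻ d +ᶻ β *ᶻ x +ᶻ γ) *ᶻ y ≡ α *ᶻ (d *ᶻ y) +ᶻ β *ᶻ (x *ᶻ y) +ᶻ γ *ᶻ y
    expand = solve-∀

  ∑-χ-⟦⟧ : ∀ c i b → ∑ᶻ.sum (λ a → χ i a *ᶻ ⟦ c ⟧ a b) ≡
    (let (α , β , γ) = c in α *ᶻ χ i b +ᶻ β *ᶻ (χ i b *ᶻ + n) +ᶻ γ *ᶻ + n)
  ∑-χ-⟦⟧ c@(α , β , γ) i b = begin
    ∑ᶻ.sum (λ a → χ i a *ᶻ ⟦ c ⟧ a b)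
      ≡⟨ ∑ᶻ.sum-cong-≗ (λ a → trans (ℤ.*-comm (χ i a) _) (cong₂ _*ᶻ_ (⟦⟧-sym c a b) (χ-sym i a))) ⟩
    ∑ᶻ.sum (λ a → ⟦ c ⟧ b a *ᶻ χ a i)
      ≡⟨ ∑-⟦⟧ c b (λ a → χ a i) ⟩
    α *ᶻ χ b i +ᶻ β *ᶻ ∑ᶻ.sum (λ a → χ b a *ᶻ χ a i) +ᶻ γ *ᶻ ∑ᶻ.sum (λ a → χ a i)
      ≡⟨ cong₂ (λ u v → α *ᶻ u +ᶻ β *ᶻ v +ᶻ γ *ᶻ ∑ᶻ.sum (λ a → χ a i)) (χ-sym b i)
               (trans (∑-χχ b i) (cong (_*ᶻ + n) (χ-sym b i))) ⟩
    α *ᶻ χ i b +ᶻ β *ᶻ (χ i b *ᶻ + n) +ᶻ γ *ᶻ ∑ᶻ.sum (λ a → χ a i)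
      ≡⟨ cong (λ t → α *ᶻ χ i b +ᶻ β *ᶻ (χ i b *ᶻ + n) +ᶻ γ *ᶻ t) (∑-χ i) ⟩
    α *ᶻ χ i b +ᶻ β *ᶻ (χ i b *ᶻ + n) +ᶻ γ *ᶻ + n
      ∎
    where open ≡-Reasoning

  ∑-⟦⟧-column : ∀ c b → ∑ᶻ.sum (λ a → ⟦ c ⟧ a b) ≡ (let (α , β , γ) = c in α +ᶻ β *ᶻ + n +ᶻ γ *ᶻ + N)
  ∑-⟦⟧-column c@(α , β , γ) b = begin
    ∑ᶻ.sum (λ a → ⟦ c ⟧ a b)
      ≡⟨ ∑ᶻ.sum-cong-≗ (λ a → trans (⟦⟧-sym c a b) (sym (ℤ.*-identityʳ _))) ⟩
    ∑ᶻ.sum (λ a → ⟦ c ⟧ b a *ᶻ + 1)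
      ≡⟨ ∑-⟦⟧ c b (λ _ → + 1) ⟩
    α *ᶻ + 1 +ᶻ β *ᶻ ∑ᶻ.sum (λ a → χ b a *ᶻ + 1) +ᶻ γ *ᶻ ∑ᶻ.sum {N} (λ _ → + 1)
      ≡⟨ cong₂ (λ u v → α *ᶻ + 1 +ᶻ β *ᶻ u +ᶻ γ *ᶻ v) ∑-row ∑-one ⟩
    α *ᶻ + 1 +ᶻ β *ᶻ + n +ᶻ γ *ᶻ + N
      ≡⟨ cong (λ u → u +ᶻ β *ᶻ + n +ᶻ γ *ᶻ + N) (ℤ.*-identityʳ α) ⟩
    α +ᶻ β *ᶻ + n +ᶻ γ *ᶻ + N
      ∎
    where
    open ≡-Reasoning
    ∑-row : ∑ᶻ.sum (λ a → χ b a *ᶻ + 1) ≡ + n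
    ∑-row = trans (∑ᶻ.sum-cong-≗ (λ a → trans (ℤ.*-identityʳ (χ b a)) (χ-sym b a))) (∑-χ b)
    ∑-one : ∑ᶻ.sum {N} (λ _ → + 1) ≡ + N
    ∑-one = trans (sym (+-∑ {N} (λ _ → 1))) (cong +_ (trans (∑-const N 1) (*-identityʳ N)))

  ∑-⟦⟧-⊛ : ∀ c c′ i b → ∑ᶻ.sum (λ a → ⟦ c ⟧ i a *ᶻ ⟦ c′ ⟧ a b) ≡ ⟦ c ⊛ c′ ⟧ i b
  ∑-⟦⟧-⊛ c@(α , β , γ) c′@(α′ , β′ , γ′) i b = begin
    ∑ᶻ.sum (λ a → ⟦ c ⟧ i a *ᶻ ⟦ c′ ⟧ a b)
      ≡⟨ ∑-⟦⟧ c i (λ a → ⟦ c′ ⟧ a b) ⟩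
    α *ᶻ ⟦ c′ ⟧ i b +ᶻ β *ᶻ ∑ᶻ.sum (λ a → χ i a *ᶻ ⟦ c′ ⟧ a b) +ᶻ γ *ᶻ ∑ᶻ.sum (λ a → ⟦ c′ ⟧ a b)
      ≡⟨ cong₂ (λ u v → α *ᶻ ⟦ c′ ⟧ i b +ᶻ β *ᶻ u +ᶻ γ *ᶻ v) (∑-χ-⟦⟧ c′ i b) (∑-⟦⟧-column c′ b) ⟩
    α *ᶻ ⟦ c′ ⟧ i b +ᶻ β *ᶻ (α′ *ᶻ χ i b +ᶻ β′ *ᶻ (χ i b *ᶻ + n) +ᶻ γ′ *ᶻ + n)
      +ᶻ γ *ᶻ (α′ +ᶻ β′ *ᶻ + n +ᶻ γ′ *ᶻ + N)
      ≡⟨ collect α β γ α′ β′ γ′ (+ n) (+ N) (δ i b) (χ i b) ⟩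
    ⟦ c ⊛ c′ ⟧ i b
      ∎
    where
    open ≡-Reasoning
    collect : ∀ α β γ α′ β′ γ′ n N d x →
      α *ᶻ (α′ *ᶻ d +ᶻ β′ *ᶻ x +ᶻ γ′) +ᶻ β *ᶻ (α′ *ᶻ x +ᶻ β′ *ᶻ (x *ᶻ n) +ᶻ γ′ *ᶻ n)
        +ᶻ γ *ᶻ (α′ +ᶻ β′ *ᶻ n +ᶻ γ′ *ᶻ N)
      ≡ α *ᶻ α′ *ᶻ d +ᶻ (α *ᶻ β′ +ᶻ β *ᶻ α′ +ᶻ n *ᶻ β *ᶻ β′) *ᶻ x
        +ᶻ (α *ᶻ γ′ +ᶻ γ *ᶻ α′ +ᶻ n *ᶻ (β *ᶻ γ′ +ᶻ γ *ᶻ β′) +ᶻ N *ᶻ γ *ᶻ γ′)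
    collect = solve-∀

  ∑-⟦⟧-transversal : ∀ c i (B : Fin N → Bool) → B i ≡ true → (∀ a → B a ≡ true → grp a ≡ grp i → a ≡ i) →
    ∑ᶻ.sum (λ a → ⟦ c ⟧ i a *ᶻ 𝟙ᶻ (B a)) ≡ (let (α , β , γ) = c in α +ᶻ β +ᶻ γ *ᶻ + count B)
  ∑-⟦⟧-transversal c@(α , β , γ) i B Bi transversal = begin
    ∑ᶻ.sum (λ a → ⟦ c ⟧ i a *ᶻ 𝟙ᶻ (B a))
      ≡⟨ ∑-⟦⟧ c i (𝟙ᶻ ∘ B) ⟩
    α *ᶻ 𝟙ᶻ (B i) +ᶻ β *ᶻ ∑ᶻ.sum (λ a → χ i a *ᶻ 𝟙ᶻ (B a)) +ᶻ γ *ᶻ ∑ᶻ.sum (𝟙ᶻ ∘ B)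
      ≡⟨ cong₂ (λ u v → α *ᶻ 𝟙ᶻ u +ᶻ β *ᶻ v +ᶻ γ *ᶻ ∑ᶻ.sum (𝟙ᶻ ∘ B)) Bi
               (trans (∑ᶻ.sum-cong-≗ meets-once) (∑ᶻ-𝟙-≟ (λ _ → + 1) i)) ⟩
    α *ᶻ + 1 +ᶻ β *ᶻ + 1 +ᶻ γ *ᶻ ∑ᶻ.sum (𝟙ᶻ ∘ B)
      ≡⟨ cong₂ (λ u v → u +ᶻ v +ᶻ γ *ᶻ ∑ᶻ.sum (𝟙ᶻ ∘ B)) (ℤ.*-identityʳ α) (ℤ.*-identityʳ β) ⟩
    α +ᶻ β +ᶻ γ *ᶻ ∑ᶻ.sum (𝟙ᶻ ∘ B)
      ≡⟨ cong (λ t → α +ᶻ β +ᶻ γ *ᶻ t) ∑-B ⟩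
    α +ᶻ β +ᶻ γ *ᶻ + count B
      ∎
    where
    open ≡-Reasoning
    meets-once : ∀ a → χ i a *ᶻ 𝟙ᶻ (B a) ≡ δ i a *ᶻ + 1
    meets-once a with i ≟ a
    ... | yes refl rewrite dec-true (grp i ≟ grp i) refl | Bi = refl
    ... | no i≢a with grp i ≟ grp a | B a in Ba
    ...   | no  _ | _     = refl
    ...   | yes _ | false = refl
    ...   | yes e | true  = ⊥-elim (i≢a (sym (transversal a Ba (sym e))))
    ∑-B : ∑ᶻ.sum (𝟙ᶻ ∘ B) ≡ + count B
    ∑-B = trans (∑ᶻ.sum-cong-≗ (sym ∘ +-𝟙 ∘ B))
      (trans (sym (+-∑ (𝟙 ∘ B))) (cong +_ (sym (sumFin≡sum (𝟙 ∘ B)))))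

module CyclicRelativeDifferenceSet (m₀ n₀ k l : ℕ) (D : Fin (suc m₀ * suc n₀) → Bool)
         (rds : IsCyclicRDS (suc m₀) (suc n₀) k l D) where

  m n N : ℕ
  m = suc m₀
  n = suc n₀
  N = m * n

  open Reduction (m∣m*n {m} n) public

  correlation : Fin N → ℕ
  correlation g = count (λ r → D r ∧ D (r ⊕ g))

  diffCount≡correlation : ∀ g → diffCount D g ≡ correlation g
  diffCount≡correlation g = begin
    sumFin (λ r₁ → count (λ r₂ → D r₁ ∧ (D r₂ ∧ does ((r₁ ⊝ r₂) ≟ g))))
      ≡⟨ trans (sumFin≡sum (λ r₁ → count (λ r₂ → D r₁ ∧ (D r₂ ∧ does ((r₁ ⊝ r₂) ≟ g)))))
           (sum-cong-≗ {N} (λ r₁ → sumFin≡sum (λ r₂ → 𝟙 (D r₁ ∧ (D r₂ ∧ does ((r₁ ⊝ r₂) ≟ g)))))) ⟩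
    ∑[ r₁ < N ] ∑[ r₂ < N ] 𝟙 (D r₁ ∧ (D r₂ ∧ does ((r₁ ⊝ r₂) ≟ g)))
      ≡⟨ ∑-comm (λ r₁ r₂ → 𝟙 (D r₁ ∧ (D r₂ ∧ does ((r₁ ⊝ r₂) ≟ g)))) ⟩
    ∑[ r₂ < N ] ∑[ r₁ < N ] 𝟙 (D r₁ ∧ (D r₂ ∧ does ((r₁ ⊝ r₂) ≟ g)))
      ≡⟨ sum-cong-≗ {N} (λ r₂ → sum-cong-≗ {N} (λ r₁ → trans (𝟙-∧-∧ (D r₁) (D r₂) (does ((r₁ ⊝ r₂) ≟ g)))
           (cong (λ b → 𝟙 b * 𝟙 (D r₁ ∧ D r₂)) (difference≡ r₁ r₂)))) ⟩
    ∑[ r₂ < N ] ∑[ r₁ < N ] (𝟙 (does ((r₂ ⊕ g) ≟ r₁)) * 𝟙 (D r₁ ∧ D r₂))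
      ≡⟨ sum-cong-≗ {N} (λ r₂ → trans (sum-𝟙-≟ (λ r₁ → 𝟙 (D r₁ ∧ D r₂)) (r₂ ⊕ g))
           (cong 𝟙 (∧-comm (D (r₂ ⊕ g)) (D r₂)))) ⟩
    ∑[ r < N ] 𝟙 (D r ∧ D (r ⊕ g))
      ≡⟨ sumFin≡sum (λ r → 𝟙 (D r ∧ D (r ⊕ g))) ⟨
    correlation g
      ∎
    where
    open ≡-Reasoning
    difference≡ : ∀ r₁ r₂ → does ((r₁ ⊝ r₂) ≟ g) ≡ does ((r₂ ⊕ g) ≟ r₁)
    difference≡ r₁ r₂ = does-⇔ (mk⇔
      (λ e → trans (⊕-comm r₂ g) (trans (cong (_⊕ r₂) (sym e)) (ℤ/.//-rightDividesˡ r₂ r₁)))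
      (λ e → trans (cong (_⊝ r₂) (trans (sym e) (⊕-comm r₂ g))) (ℤ/.//-rightDividesʳ r₂ g)))
      ((r₁ ⊝ r₂) ≟ g) ((r₂ ⊕ g) ≟ r₁)

  correlation-zero : correlation fzero ≡ k
  correlation-zero = trans (count-cong (λ r → trans (cong (λ s → D r ∧ D s) (⊕-identityʳ r)) (∧-idem (D r))))
                           (proj₁ rds)

  correlation-within : ∀ a b → a ≢ b → reduce a ≡ reduce b → correlation (a ⊝ b) ≡ 0
  correlation-within a b a≢b a∼b = trans (sym (diffCount≡correlation (a ⊝ b)))
    (proj₂ (proj₂ rds) (a ⊝ b) (reduce-≡⇒∣ a b a∼b) (a≢b ∘ ℤ/.x∙y⁻¹≈ε⇒x≈y a b ∘ toℕ-injective))

  correlation-across : ∀ a b → reduce a ≢ reduce b → correlation (a ⊝ b) ≡ l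
  correlation-across a b a≁b = trans (sym (diffCount≡correlation (a ⊝ b)))
    (proj₁ (proj₂ rds) (a ⊝ b) (a≁b ∘ ∣⇒reduce-≡ a b))

  -- Block B is the translate B − D, so p lies on B iff B − p ∈ D, as a^p ∼ a^B b in the Cayley graph.
  inc : Fin N → Fin N → Bool
  inc p B = D ((⊖ p) ⊕ B)

  commonBlocks : ∀ p q → count (λ B → inc p B ∧ inc q B) ≡ correlation (p ⊝ q)
  commonBlocks p q = trans (count-permute (translation p) (λ B → inc p B ∧ inc q B))
    (count-cong (λ r → cong₂ (λ s t → D s ∧ D t) (ℤ/.\\-leftDividesʳ p r) (⊖-⊕-shift q p r)))

  commonPoints : ∀ B B′ → count (λ p → inc p B ∧ inc p B′) ≡ correlation (B′ ⊝ B)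
  commonPoints B B′ = trans (count-permute (reflection B) (λ p → inc p B ∧ inc p B′))
    (count-cong (λ r → cong₂ (λ s t → D s ∧ D t) (trans (opposite r B) (cancel r)) (opposite r B′)))
    where
    opposite : ∀ r C → (⊖ (B ⊝ r)) ⊕ C ≡ r ⊕ (C ⊝ B)
    opposite r C = trans (cong (_⊕ C) (ℤ/.⁻¹-anti-homo‿- B r)) (⊝-⊕-shift r B C)
    cancel : ∀ r → r ⊕ (B ⊝ B) ≡ r
    cancel r = trans (cong (r ⊕_) (⊕-inverseʳ B)) (⊕-identityʳ r)

  blockSize : ∀ B → count (λ p → inc p B) ≡ k
  blockSize B = trans (count-cong (λ p → sym (∧-idem (inc p B))))
    (trans (commonPoints B B) (trans (cong correlation (⊕-inverseʳ B)) correlation-zero))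

  replication : ∀ p → count (λ B → inc p B) ≡ k
  replication p = trans (count-cong (λ B → sym (∧-idem (inc p B))))
    (trans (commonBlocks p p) (trans (cong correlation (⊕-inverseʳ p)) correlation-zero))

  fibre : ∀ c → count (λ p → does (reduce p ≟ c)) ≡ n
  fibre = count-mod m n

  design : IsGDD n m k 0 l inc
  design = reduce , fibre , blockSize ,
    (λ p q p≢q p∼q → trans (commonBlocks p q) (correlation-within p q p≢q p∼q)) ,
    (λ p q p≁q → trans (commonBlocks p q) (correlation-across p q p≁q))

  dualDesign : IsGDD n m k 0 l (flip inc)
  dualDesign = reduce , fibre , replication ,
    (λ B B′ B≢B′ B∼B′ → trans (commonPoints B B′) (correlation-within B′ B (B≢B′ ∘ sym) (sym B∼B′))) ,
    (λ B B′ B≁B′ → trans (commonPoints B B′) (correlation-across B′ B (B≁B′ ∘ sym)))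

  Γ : FinGraph
  Γ = DihGraph N D

  open WalkCounts Γ

  pt bl : Fin N → Dih N
  pt i = i , false
  bl j = j , true

  incidenceIso : Γ ≅ IncidenceGraph inc
  incidenceIso = mk↔ₛ′ toIncidence fromIncidence to∘from from∘to , adj-preserved
    where
    toIncidence : Dih N → Fin N ⊎ Fin N
    toIncidence (i , false) = inj₁ i
    toIncidence (j , true)  = inj₂ j
    fromIncidence : Fin N ⊎ Fin N → Dih N
    fromIncidence (inj₁ i) = pt i
    fromIncidence (inj₂ j) = bl j
    to∘from : ∀ x → toIncidence (fromIncidence x) ≡ x
    to∘from (inj₁ i) = refl
    to∘from (inj₂ j) = refl
    from∘to : ∀ x → fromIncidence (toIncidence x) ≡ x
    from∘to (i , false) = refl
    from∘to (j , true)  = refl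
    adj-preserved : ∀ x y → adj Γ x y ≡ adj (IncidenceGraph inc) (toIncidence x) (toIncidence y)
    adj-preserved (i , false) (j , false) = refl
    adj-preserved (i , false) (j , true)  = refl
    adj-preserved (i , true)  (j , false) = cong D (⊕-comm i (⊖ j))
    adj-preserved (i , true)  (j , true)  = refl

  ∑ᵥ-Dih : ∀ f → ∑ᵥ f ≡ ∑[ a < N ] (f (pt a) + f (bl a))
  ∑ᵥ-Dih f = trans (∑-combine N 2 (f′ ∘ remQuot 2)) (sum-cong-≗ {N} (λ a →
    cong₂ _+_ (cong f′ (remQuot-combine a fzero))
              (trans (cong (λ t → f′ t + 0) (remQuot-combine a (fsuc fzero))) (+-identityʳ (f (bl a))))))
    where
    f′ : Fin N × Fin 2 → ℕ
    f′ (a , b) = f (a , Inverse.to 2↔Bool b)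

  walks-two-pt-pt : ∀ a b → walks Γ 2 (pt a) (pt b) ≡ correlation (a ⊝ b)
  walks-two-pt-pt a b = begin
    walks Γ 2 (pt a) (pt b)
      ≡⟨ trans (walks-suc 1 (pt a) (pt b)) (∑ᵥ-Dih (λ z → 𝟙 (adj Γ (pt a) z) * walks Γ 1 z (pt b))) ⟩
    ∑[ c < N ] (𝟙 (inc a c) * walks Γ 1 (bl c) (pt b))
      ≡⟨ sum-cong-≗ {N} (λ c → trans (cong (𝟙 (inc a c) *_) (walks-one (bl c) (pt b)))
           (trans (𝟙-∧ (inc a c) (D (c ⊝ b))) (cong (λ s → 𝟙 (inc a c ∧ D s)) (⊕-comm c (⊖ b))))) ⟩
    ∑[ c < N ] 𝟙 (inc a c ∧ inc b c)
      ≡⟨ sumFin≡sum (λ c → 𝟙 (inc a c ∧ inc b c)) ⟨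
    count (λ c → inc a c ∧ inc b c)
      ≡⟨ commonBlocks a b ⟩
    correlation (a ⊝ b)
      ∎
    where open ≡-Reasoning

  walks-two-pt-bl : ∀ a b → walks Γ 2 (pt a) (bl b) ≡ 0
  walks-two-pt-bl a b = begin
    walks Γ 2 (pt a) (bl b)
      ≡⟨ trans (walks-suc 1 (pt a) (bl b)) (∑ᵥ-Dih (λ z → 𝟙 (adj Γ (pt a) z) * walks Γ 1 z (bl b))) ⟩
    ∑[ c < N ] (𝟙 (inc a c) * walks Γ 1 (bl c) (bl b))
      ≡⟨ sum-cong-≗ {N} (λ c → trans (cong (𝟙 (inc a c) *_) (walks-one (bl c) (bl b))) (*-zeroʳ (𝟙 (inc a c)))) ⟩
    ∑[ c < N ] 0
      ≡⟨ sum-replicate-zero N ⟩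
    0 ∎
    where open ≡-Reasoning

  walks-pt-pt-step : ∀ ℓ i b → walks Γ (2 + ℓ) (pt i) (pt b) ≡ ∑[ a < N ] (correlation (i ⊝ a) * walks Γ ℓ (pt a) (pt b))
  walks-pt-pt-step ℓ i b = trans (walks-+ 2 ℓ (pt i) (pt b))
    (trans (∑ᵥ-Dih (λ z → walks Γ 2 (pt i) z * walks Γ ℓ z (pt b))) (sum-cong-≗ {N} (λ a →
      trans (cong₂ _+_ (cong (_* walks Γ ℓ (pt a) (pt b)) (walks-two-pt-pt i a))
                       (cong (_* walks Γ ℓ (bl a) (pt b)) (walks-two-pt-bl i a)))
            (+-identityʳ _))))

  walks-pt-bl-step : ∀ ℓ i j → walks Γ (suc ℓ) (pt i) (bl j) ≡ ∑[ a < N ] (walks Γ ℓ (pt i) (pt a) * 𝟙 (inc a j))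
  walks-pt-bl-step ℓ i j = trans (cong (λ L → walks Γ L (pt i) (bl j)) (+-comm 1 ℓ))
    (trans (walks-+ ℓ 1 (pt i) (bl j))
    (trans (∑ᵥ-Dih (λ z → walks Γ ℓ (pt i) z * walks Γ 1 z (bl j))) (sum-cong-≗ {N} (λ a →
      trans (cong₂ _+_ (cong (walks Γ ℓ (pt i) (pt a) *_) (walks-one (pt a) (bl j)))
                       (trans (cong (walks Γ ℓ (pt i) (bl a) *_) (walks-one (bl a) (bl j))) (*-zeroʳ (walks Γ ℓ (pt i) (bl a)))))
            (+-identityʳ _)))))

  open GroupDivisibleMatrices reduce n fibre

  -- The square of the adjacency matrix, restricted to points, is kI + λ(J − K).
  blockCoeffs : Coeffs
  blockCoeffs = + k , -ᶻ + l , + l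

  correlation-⟦⟧ : ∀ a b → + correlation (a ⊝ b) ≡ ⟦ blockCoeffs ⟧ a b
  correlation-⟦⟧ a b = by-cases (a ≟ b) (reduce a ≟ reduce b)
    where
    open ≡-Reasoning
    cancel : ∀ x y → x ≡ x +ᶻ -ᶻ y +ᶻ y
    cancel = solve-∀
    by-cases : Dec (a ≡ b) → Dec (reduce a ≡ reduce b) → + correlation (a ⊝ b) ≡ ⟦ blockCoeffs ⟧ a b
    by-cases (yes refl) _ = begin
      + correlation (a ⊝ a)    ≡⟨ cong (+_ ∘ correlation) (⊕-inverseʳ a) ⟩
      + correlation fzero      ≡⟨ cong +_ correlation-zero ⟩
      + k                      ≡⟨ cancel (+ k) (+ l) ⟩
      + k +ᶻ -ᶻ + l +ᶻ + l     ≡⟨ ⟦⟧-diagonal blockCoeffs a ⟨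
      ⟦ blockCoeffs ⟧ a a      ∎
    by-cases (no a≢b) (yes a∼b) = trans (cong +_ (correlation-within a b a≢b a∼b))
      (sym (trans (⟦⟧-within blockCoeffs a b a≢b a∼b) (ℤ.+-inverseˡ (+ l))))
    by-cases (no _) (no a≁b) = trans (cong +_ (correlation-across a b a≁b)) (sym (⟦⟧-apart blockCoeffs a b a≁b))

  walkCoeffs : ℕ → Coeffs
  walkCoeffs zero          = + 1 , + 0 , + 0
  walkCoeffs (suc zero)    = + 0 , + 0 , + 0
  walkCoeffs (suc (suc ℓ)) = blockCoeffs ⊛ walkCoeffs ℓ

  walks-pt-pt : ∀ ℓ i b → + walks Γ ℓ (pt i) (pt b) ≡ ⟦ walkCoeffs ℓ ⟧ i b
  walks-pt-pt zero i b = trans (cong +_ (walks-zero (i ≟ b) (pt i) (pt b) (mk⇔ (cong proj₁) (cong pt))))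
    (trans (+-𝟙 (does (i ≟ b))) (identity (δ i b) (χ i b)))
    where
    identity : ∀ d x → d ≡ + 1 *ᶻ d +ᶻ + 0 *ᶻ x +ᶻ + 0
    identity = solve-∀
  walks-pt-pt (suc zero) i b = cong +_ (walks-one (pt i) (pt b))
  walks-pt-pt (suc (suc ℓ)) i b = begin
    + walks Γ (2 + ℓ) (pt i) (pt b)
      ≡⟨ cong +_ (walks-pt-pt-step ℓ i b) ⟩
    + ∑[ a < N ] (correlation (i ⊝ a) * walks Γ ℓ (pt a) (pt b))
      ≡⟨ +-∑ (λ a → correlation (i ⊝ a) * walks Γ ℓ (pt a) (pt b)) ⟩
    ∑ᶻ.sum (λ a → + (correlation (i ⊝ a) * walks Γ ℓ (pt a) (pt b)))
      ≡⟨ ∑ᶻ.sum-cong-≗ (λ a → trans (ℤ.pos-* (correlation (i ⊝ a)) _)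
           (cong₂ _*ᶻ_ (correlation-⟦⟧ i a) (walks-pt-pt ℓ a b))) ⟩
    ∑ᶻ.sum (λ a → ⟦ blockCoeffs ⟧ i a *ᶻ ⟦ walkCoeffs ℓ ⟧ a b)
      ≡⟨ ∑-⟦⟧-⊛ blockCoeffs (walkCoeffs ℓ) i b ⟩
    ⟦ walkCoeffs (2 + ℓ) ⟧ i b
      ∎
    where open ≡-Reasoning

  -- Two points of a block in one group would make their difference, a nonzero element of N, a difference of D.
  block-meets-group-once : ∀ {i j} → inc i j ≡ true → ∀ a → inc a j ≡ true → reduce a ≡ reduce i → a ≡ i
  block-meets-group-once {i} {j} ij a aj a∼i with a ≟ i
  ... | yes a≡i = a≡i
  ... | no  a≢i = ⊥-elim (<-irrefl refl (begin-strict
    0                                   <⟨ subst (λ b → 0 < 𝟙 b) (sym (cong₂ _∧_ aj ij)) z<s ⟩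
    𝟙 (inc a j ∧ inc i j)               ≤⟨ ∑-≤ (λ B → 𝟙 (inc a B ∧ inc i B)) j ⟩
    ∑[ B < N ] 𝟙 (inc a B ∧ inc i B)    ≡⟨ sumFin≡sum (λ B → 𝟙 (inc a B ∧ inc i B)) ⟨
    count (λ B → inc a B ∧ inc i B)     ≡⟨ commonBlocks a i ⟩
    correlation (a ⊝ i)                 ≡⟨ correlation-within a i a≢i a∼i ⟩
    0                                   ∎))
    where open ≤-Reasoning

  diagonalWalks adjacentWalks distantWalks : ℕ → ℤ
  diagonalWalks ℓ = let (α , β , γ) = walkCoeffs ℓ in α +ᶻ β +ᶻ γ
  adjacentWalks zero    = + 0
  adjacentWalks (suc ℓ) = let (α , β , γ) = walkCoeffs ℓ in α +ᶻ β +ᶻ γ *ᶻ + k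
  distantWalks ℓ = let (_ , _ , γ) = walkCoeffs ℓ in γ

  walks-pt-bl : ∀ ℓ i j → inc i j ≡ true → + walks Γ ℓ (pt i) (bl j) ≡ adjacentWalks ℓ
  walks-pt-bl zero    i j _  = cong +_ (walks-zero-≢ {pt i} {bl j} λ ())
  walks-pt-bl (suc ℓ) i j ij = begin
    + walks Γ (suc ℓ) (pt i) (bl j)
      ≡⟨ cong +_ (walks-pt-bl-step ℓ i j) ⟩
    + ∑[ a < N ] (walks Γ ℓ (pt i) (pt a) * 𝟙 (inc a j))
      ≡⟨ +-∑ (λ a → walks Γ ℓ (pt i) (pt a) * 𝟙 (inc a j)) ⟩
    ∑ᶻ.sum (λ a → + (walks Γ ℓ (pt i) (pt a) * 𝟙 (inc a j)))
      ≡⟨ ∑ᶻ.sum-cong-≗ (λ a → trans (ℤ.pos-* (walks Γ ℓ (pt i) (pt a)) _)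
           (cong₂ _*ᶻ_ (walks-pt-pt ℓ i a) (+-𝟙 (inc a j)))) ⟩
    ∑ᶻ.sum (λ a → ⟦ walkCoeffs ℓ ⟧ i a *ᶻ 𝟙ᶻ (inc a j))
      ≡⟨ ∑-⟦⟧-transversal (walkCoeffs ℓ) i (λ a → inc a j) ij (block-meets-group-once ij) ⟩
    (let (α , β , γ) = walkCoeffs ℓ in α +ᶻ β +ᶻ γ *ᶻ + count (λ a → inc a j))
      ≡⟨ cong (λ s → let (α , β , γ) = walkCoeffs ℓ in α +ᶻ β +ᶻ γ *ᶻ + s) (blockSize j) ⟩
    adjacentWalks (suc ℓ)
      ∎
    where open ≡-Reasoning

  walks-pt-pt-distant : ∀ ℓ i a → i ≢ a → 0 < walks Γ 2 (pt i) (pt a) → + walks Γ ℓ (pt i) (pt a) ≡ distantWalks ℓ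
  walks-pt-pt-distant ℓ i a i≢a p = trans (walks-pt-pt ℓ i a) (⟦⟧-apart (walkCoeffs ℓ) i a i≁a)
    where
    i≁a : reduce i ≢ reduce a
    i≁a i∼a = <-irrefl (sym (trans (walks-two-pt-pt i a) (correlation-within i a i≢a i∼a))) p

  -- Left multiplication by b: an automorphism of the Cayley graph exchanging points and blocks.
  σ : Dih N → Dih N
  σ (i , s) = ⊖ i , not s

  σ-involutive : ∀ x → σ (σ x) ≡ x
  σ-involutive (i , false) = cong (_, false) (ℤ/.⁻¹-involutive i)
  σ-involutive (i , true)  = cong (_, true) (ℤ/.⁻¹-involutive i)

  σ-adj : ∀ x y → adj Γ (σ x) (σ y) ≡ adj Γ x y
  σ-adj (i , false) (j , false) = refl
  σ-adj (i , false) (j , true)  = cong (λ u → D ((⊖ i) ⊕ u)) (ℤ/.⁻¹-involutive j)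
  σ-adj (i , true)  (j , false) = cong (λ u → D (u ⊕ (⊖ j))) (ℤ/.⁻¹-involutive i)
  σ-adj (i , true)  (j , true)  = refl

  walks-σ : ∀ ℓ x y → walks Γ ℓ x y ≡ walks Γ ℓ (σ x) (σ y)
  walks-σ ℓ x y = sym (walks-automorphism (mk↔ₛ′ σ σ σ-involutive σ-involutive) σ-adj ℓ x y)

  walks-diagonal : ∀ ℓ x → + walks Γ ℓ x x ≡ diagonalWalks ℓ
  walks-diagonal ℓ (i , false) = trans (walks-pt-pt ℓ i i) (⟦⟧-diagonal (walkCoeffs ℓ) i)
  walks-diagonal ℓ (j , true)  = trans (cong +_ (walks-σ ℓ (bl j) (bl j)))
    (trans (walks-pt-pt ℓ (⊖ j) (⊖ j)) (⟦⟧-diagonal (walkCoeffs ℓ) (⊖ j)))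

  walks-adjacent : ∀ ℓ x y → adj Γ x y ≡ true → + walks Γ ℓ x y ≡ adjacentWalks ℓ
  walks-adjacent ℓ (i , false) (j , true)  e = walks-pt-bl ℓ i j e
  walks-adjacent ℓ (i , true)  (j , false) e = trans (cong +_ (walks-σ ℓ (bl i) (pt j)))
    (walks-pt-bl ℓ (⊖ i) (⊖ j) (trans (σ-adj (bl i) (pt j)) e))

  walks-distant : ∀ ℓ x y → x ≢ y → 0 < walks Γ 2 x y → + walks Γ ℓ x y ≡ distantWalks ℓ
  walks-distant ℓ (i , false) (a , false) x≢y p = walks-pt-pt-distant ℓ i a (x≢y ∘ cong pt) p
  walks-distant ℓ (i , false) (a , true)  _   p = ⊥-elim (<-irrefl (sym (walks-two-pt-bl i a)) p)
  walks-distant ℓ (i , true)  (a , false) _   p =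
    ⊥-elim (<-irrefl (sym (trans (walks-σ 2 (bl i) (pt a)) (walks-two-pt-bl (⊖ i) (⊖ a)))) p)
  walks-distant ℓ (i , true)  (a , true)  x≢y p = trans (cong +_ (walks-σ ℓ (bl i) (bl a)))
    (walks-pt-pt-distant ℓ (⊖ i) (⊖ a) (x≢y ∘ cong bl ∘ ℤ/.⁻¹-injective) (subst (0 <_) (walks-σ 2 (bl i) (bl a)) p))

  distanceWalks : ℕ → ℕ → ℤ
  distanceWalks zero          = diagonalWalks
  distanceWalks (suc zero)    = adjacentWalks
  distanceWalks (suc (suc _)) = distantWalks

  walks-by-distance : ∀ j x y → j ≤ 2 → Dist Γ x y j → ∀ ℓ → + walks Γ ℓ x y ≡ distanceWalks j ℓ
  walks-by-distance zero x y _ (p , _) ℓ with walks-zero-pos {x} {y} p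
  ... | refl = walks-diagonal ℓ x
  walks-by-distance (suc zero) x y _ (p , _) ℓ =
    walks-adjacent ℓ x y (𝟙-pos (subst (0 <_) (walks-one x y) p))
  walks-by-distance (suc (suc zero)) x y _ (p , q) ℓ =
    walks-distant ℓ x y (λ { refl → 0≢1+n (trans (sym (q 0 z<s)) (walks-zero-refl x)) }) p
  walks-by-distance (suc (suc (suc _))) _ _ (s≤s (s≤s ())) _ _

  module _ (g : Fin N) (g∉N : ¬ m ∣ toℕ g) where

    diameter≥2 : DiameterAtLeast2 Γ
    diameter≥2 = pt fzero , pt g , walks-zero-≢ g≢0 , walks-one (pt fzero) (pt g)
      where
      g≢0 : pt fzero ≢ pt g
      g≢0 e = g∉N (subst (λ h → m ∣ toℕ h) (cong proj₁ e) (m ∣0))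

    twoWalkRegular : TwoWalkRegular Γ
    twoWalkRegular = diameter≥2 , λ ℓ j x y x′ y′ j≤2 d d′ →
      ℤ.+-injective (trans (walks-by-distance j x y j≤2 d ℓ) (sym (walks-by-distance j x′ y′ j≤2 d′ ℓ)))

    module _ (1≤k : 1 ≤ k) (1≤l : 1 ≤ l) where

      walk-across-groups : ∀ i a → reduce i ≢ reduce a → 0 < walks Γ 2 (pt i) (pt a)
      walk-across-groups i a i≁a = subst (0 <_) (sym (trans (walks-two-pt-pt i a) (correlation-across i a i≁a))) 1≤l

      block-nonempty : ∀ j → ∃[ p ] 0 < 𝟙 (inc p j)
      block-nonempty j = ∑-pos (λ p → 𝟙 (inc p j))
        (subst (0 <_) (trans (sym (blockSize j)) (sumFin≡sum (λ p → 𝟙 (inc p j)))) 1≤k)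

      reach-pt : ∀ i a → ∃[ ℓ ] 0 < walks Γ ℓ (pt i) (pt a)
      reach-pt i a with reduce i ≟ reduce a
      ... | no  i≁a = 2 , walk-across-groups i a i≁a
      ... | yes i∼a = 4 , ≤-trans (*-mono-≤ (walk-across-groups i z i≁z) (walk-across-groups z a z≁a))
                                 (walks-through 2 2 (pt i) (pt z) (pt a))
        where
        z : Fin N
        z = a ⊕ g
        z≁a : reduce z ≢ reduce a
        z≁a z∼a = g∉N (reduce≡0⇒∣ g (ℤ/.identityʳ-unique (reduce a) (reduce g) (trans (sym (reduce-⊕ a g)) z∼a)))
        i≁z : reduce i ≢ reduce z
        i≁z i∼z = z≁a (trans (sym i∼z) i∼a)

      reach-bl : ∀ i j → ∃[ ℓ ] 0 < walks Γ ℓ (pt i) (bl j)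
      reach-bl i j =
        let (p , p∈j) = block-nonempty j
            (ℓ , q)   = reach-pt i p
        in ℓ + 1 , ≤-trans (*-mono-≤ q (subst (0 <_) (sym (walks-one (pt p) (bl j))) p∈j))
                           (walks-through ℓ 1 (pt i) (pt p) (bl j))

      reach : ∀ i y → ∃[ ℓ ] 0 < walks Γ ℓ (pt i) y
      reach i (a , false) = reach-pt i a
      reach i (j , true)  = reach-bl i j

      connected : Connected Γ
      connected (i , false) y = reach i y
      connected (c , true)  y = let (ℓ , q) = reach (⊖ c) (σ y) in ℓ , subst (0 <_) (sym (walks-σ ℓ (bl c) y)) q

proposition5p1 : (m n k l : ℕ) → 2 ≤ m → 2 ≤ n → 1 ≤ k → 1 ≤ l →
    (D : Fin (m * n) → Bool) → IsCyclicRDS m n k l D →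
    (Σ ℕ λ v → Σ ℕ λ b → Σ (Fin v → Fin b → Bool) λ inc →
      IsGDDDual n m k 0 l inc × (DihGraph (m * n) D ≅ IncidenceGraph inc))
    × Connected (DihGraph (m * n) D)
    × TwoWalkRegular (DihGraph (m * n) D)
proposition5p1 0             _             _ _ () _  _ _ _ _
proposition5p1 1             _             _ _ (s≤s ()) _ _ _ _ _
proposition5p1 (suc (suc _)) 0             _ _ _ () _ _ _ _
proposition5p1 (suc (suc _)) 1             _ _ _ (s≤s ()) _ _ _ _
proposition5p1 (suc (suc m₀)) (suc (suc n₀)) k l _ _ 1≤k 1≤l D rds =
  (N , N , inc , (design , dualDesign) , incidenceIso) ,
  connected one one∉N 1≤k 1≤l ,
  twoWalkRegular one one∉N
  where
  open CyclicRelativeDifferenceSet (suc m₀) (suc n₀) k l D rds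
  one : Fin N
  one = fsuc fzero
  one∉N : ¬ m ∣ 1
  one∉N m∣1 = 1+n≢0 (suc-injective (∣1⇒≡1 m∣1))
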